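{- If $G$ is an $n$-vertex complete $k$-partite graph with part-sizes $r_1,\dots,r_k$, then $\mathring{s}(G)\le n+2\sum_{1\le i<j\le k}\sqrt{r_ir_j}$.
   Context: The slow-coloring game on a graph $G$: initially all vertices are uncolored. In each round, Lister marks a nonempty set $M$ of uncolored vertices and scores $|M|$; Painter then colors (with a new color) a subset $X\subseteq M$ that is independent in $G$. The game ends when all vertices are colored; the score is the sum of the sizes of all marked sets. Painter minimizes, Lister maximizes. The sum-color cost $\mathring{s}(G)$ is the score under optimal play by both players. -}

module Defs where

open import Data.Bool using (Bool; true; false; _∧_; not; if_then_else_)
open import Data.Nat using (ℕ; zero; suc; _+_; _⊔_; _⊓_; _<ᵇ_)
open import Data.Fin using (Fin; toℕ; _≟_)
open import Data.Vec using (Vec; []; _∷_; lookup; replicate)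
open import Data.List as L using (List; []; _∷_; [_]; filterᵇ; allFin; foldr; concatMap; length)
open import Data.Product using (_×_; _,_)
open import Data.Integer using (+_)
open import Data.Rational as Q using (ℚ; 0ℚ; _/_)
open import Relation.Nullary.Decidable using (⌊_⌋)

-- A (loopless, symmetric) graph on the vertex set Fin n, given by a Boolean adjacency function.
Graph : ℕ → Set
Graph n = Fin n → Fin n → Bool

VSet : ℕ → Set
VSet n = Vec Bool n

allSubsets : (n : ℕ) → List (VSet n)
allSubsets zero = [ [] ]
allSubsets (suc n) = L.map (false ∷_) (allSubsets n) L.++ L.map (true ∷_) (allSubsets n)

size : ∀ {n} → VSet n → ℕ
size [] = 0
size (true ∷ xs) = suc (size xs)
size (false ∷ xs) = size xs

nonempty : ∀ {n} → VSet n → Bool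
nonempty [] = false
nonempty (true ∷ xs) = true
nonempty (false ∷ xs) = nonempty xs

isSub : ∀ {n} → VSet n → VSet n → Bool
isSub [] [] = true
isSub (true ∷ xs) (false ∷ ys) = false
isSub (_ ∷ xs) (_ ∷ ys) = isSub xs ys

minus : ∀ {n} → VSet n → VSet n → VSet n
minus [] [] = []
minus (u ∷ us) (x ∷ xs) = (u ∧ not x) ∷ minus us xs

allᵇ : {A : Set} → (A → Bool) → List A → Bool
allᵇ p = foldr (λ x b → p x ∧ b) true

independent : ∀ {n} → Graph n → VSet n → Bool
independent {n} G X =
  allᵇ (λ u → allᵇ (λ v → not (lookup X u ∧ lookup X v ∧ G u v)) (allFin n)) (allFin n)

maxL : List ℕ → ℕ
maxL = foldr _⊔_ 0

minL : List ℕ → ℕ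
minL [] = 0
minL (x ∷ xs) = foldr _⊓_ x xs

listerMoves : ∀ {n} → VSet n → List (VSet n)
listerMoves {n} U = filterᵇ (λ M → nonempty M ∧ isSub M U) (allSubsets n)

painterMoves : ∀ {n} → Graph n → VSet n → List (VSet n)
painterMoves {n} G M = filterᵇ (λ X → nonempty X ∧ isSub X M ∧ independent G X) (allSubsets n)

-- Value of the slow-coloring game (remaining score under optimal play) from
-- uncolored set U, with a fuel bound on the number of rounds.  Every round colors
-- at least one vertex, so fuel ≥ size U gives the exact value.
gameValue : ∀ {n} → Graph n → ℕ → VSet n → ℕ
gameValue G zero U = 0
gameValue G (suc f) U =
  maxL (L.map (λ M → size M + minL (L.map (λ X → gameValue G f (minus U X)) (painterMoves G M)))
              (listerMoves U))

sumColorCost : ∀ {n} → Graph n → ℕ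
sumColorCost {n} G = gameValue G n (replicate n true)

completeMultipartite : ∀ {n k} → (Fin n → Fin k) → Graph n
completeMultipartite part u v = not ⌊ part u ≟ part v ⌋

partSize : ∀ {n k} → (Fin n → Fin k) → Fin k → ℕ
partSize {n} part i = length (filterᵇ (λ v → ⌊ part v ≟ i ⌋) (allFin n))

orderedPairs : (k : ℕ) → List (Fin k × Fin k)
orderedPairs k = concatMap (λ i → L.map (λ j → (i , j)) (filterᵇ (λ j → toℕ i <ᵇ toℕ j) (allFin k))) (allFin k)

pairSumℚ : (k : ℕ) → (Fin k → Fin k → ℚ) → ℚ
pairSumℚ k q = foldr (λ p acc → q (Data.Product.proj₁ p) (Data.Product.proj₂ p) Q.+ acc) 0ℚ (orderedPairs k)

ℕtoℚ : ℕ → ℚ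
ℕtoℚ m = (+ m) / 1

module Submission where

-- Painter plays a potential strategy.  A Certificate for the uncolored class
-- sizes u is a budget s_i ≥ u_i per class and symmetric weights p_ij ≥ 0 with
-- zero diagonal and s_i s_j ≤ p_ij² (i ≠ j); its potential is
-- Φ = ∑ s + ∑_{i,j} p_ij.  If Lister marks m_i vertices of class i, let
-- x_i = m_i / s_i.  Weighted AM–GM gives (∑ m)² ≤ ∑ m_i (m_i + x_i ∑_j p_ij), so
-- by averaging some marked class has price m_i + x_i ∑_j p_ij ≥ ∑ m.  Painter
-- colors its marked vertices (an independent set); lowering s_i by m_i and
-- damping the weights of class i by 1 - x_i/2 gives a certificate whose
-- potential is lower by exactly the price (painter-round).  By induction on the
-- rounds the game value is at most Φ (Game.game-bound), and the initial
-- certificate s = r, p_ij = q_ij + q_ji (q kept only for i < j) has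
-- Φ = n + 2 ∑_{i<j} q_ij.

open import Algebra.Bundles using (Ring)
import Algebra.Properties.Semiring.Sum as SemiringSum
open import Data.Bool using (Bool; true; false; _∧_; not; if_then_else_)
open import Data.Bool.Properties using (∧-conicalˡ; ∧-conicalʳ; T-≡)
open import Data.Fin using (Fin; zero; suc; _≟_; toℕ)
open import Data.Fin.Properties using (toℕ-injective; any?)
open import Data.Integer as ℤ using ()
import Data.Integer.Properties as ℤ
open import Data.List as List using (List; []; _∷_; allFin; length; filterᵇ)
open import Data.List.Membership.Propositional using (_∈_)
open import Data.List.Membership.Propositional.Properties using (∈-map⁺; ∈-map⁻; ∈-++⁺ˡ; ∈-++⁺ʳ; ∈-filter⁺; ∈-filter⁻)
open import Data.List.Relation.Unary.Any using (here; there)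
open import Data.Nat as ℕ using (ℕ; zero; suc; _<ᵇ_)
import Data.Nat.Properties as ℕ
open import Data.Nat.Coprimality as Coprime using (1-coprimeTo)
open import Data.Product using (∃; _×_; _,_; proj₁; proj₂)
open import Data.Rational as ℚ using (ℚ; 0ℚ; 1ℚ; ½; mkℚ; _+_; _-_; -_; _≤_; 1/_) renaming (_*_ to _·_)
open import Data.Rational.Properties hiding (_≟_)
open import Data.Rational.Solver using (module +-*-Solver)
import Data.Rational.Unnormalised as ℚᵘ
import Data.Rational.Unnormalised.Properties as ℚᵘ
open import Data.Sum using (_⊎_; inj₁; inj₂)
open import Data.Vec using ([]; _∷_; lookup; replicate; tabulate)
open import Data.Vec.Properties using (lookup∘tabulate; lookup-replicate)
open import Function using (_∘_; id)
open import Function.Bundles using (module Equivalence)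
open import Relation.Binary using (tri<; tri≈; tri>)
open import Relation.Binary.PropositionalEquality as ≡
  using (_≡_; _≢_; refl; cong; cong₂; subst; subst₂; module ≡-Reasoning)
open import Relation.Nullary using (Dec; yes; no; ¬_; contradiction)
open import Relation.Nullary.Decidable using (⌊_⌋; ⌊⌋-map′; T?; _×-dec_)
open import Defs
open +-*-Solver

ι : ℕ → ℚ
ι a = mkℚ (ℤ.+ a) 0 (Coprime.sym (1-coprimeTo a))

ℕtoℚ≡ι : ∀ a → ℕtoℚ a ≡ ι a
ℕtoℚ≡ι a = ↥p/↧p≡p (ι a)

ι-+ : ∀ a b → ι (a ℕ.+ b) ≡ ι a + ι b
ι-+ a b = toℚᵘ-injective (ℚᵘ.≃-trans (ℚᵘ.*≡* cross) (ℚᵘ.≃-sym (toℚᵘ-homo-+ (ι a) (ι b))))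
  where
  cross : ℤ.+ (a ℕ.+ b) ℤ.* ℤ.+ 1 ≡ (ℤ.+ a ℤ.* ℤ.+ 1 ℤ.+ ℤ.+ b ℤ.* ℤ.+ 1) ℤ.* ℤ.+ 1
  cross = cong (ℤ._* ℤ.+ 1) (≡.trans (ℤ.pos-+ a b) (≡.sym (cong₂ ℤ._+_ (ℤ.*-identityʳ (ℤ.+ a)) (ℤ.*-identityʳ (ℤ.+ b)))))

ι-* : ∀ a b → ι (a ℕ.* b) ≡ ι a · ι b
ι-* a b = toℚᵘ-injective (ℚᵘ.≃-trans (ℚᵘ.*≡* (cong (ℤ._* ℤ.+ 1) (ℤ.pos-* a b))) (ℚᵘ.≃-sym (toℚᵘ-homo-* (ι a) (ι b))))

ι-mono : ∀ {a b} → a ℕ.≤ b → ι a ≤ ι b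
ι-mono a≤b = ℚ.*≤* (ℤ.*-monoʳ-≤-nonNeg (ℤ.+ 1) (ℤ.+≤+ a≤b))

ι-nonNeg : ∀ a → 0ℚ ≤ ι a
ι-nonNeg a = ι-mono ℕ.z≤n

ι-pos : ∀ {a} → 0 ℕ.< a → 0ℚ ℚ.< ι a
ι-pos 0<a = ℚ.*<* (ℤ.*-monoʳ-<-pos (ℤ.+ 1) (ℤ.+<+ 0<a))

0≤1 : 0ℚ ≤ 1ℚ
0≤1 = ℚ.*≤* (ℤ.+≤+ ℕ.z≤n)

0≤½ : 0ℚ ≤ ½
0≤½ = ℚ.*≤* (ℤ.+≤+ ℕ.z≤n)

≤-by-gap : ∀ {a b} c → 0ℚ ≤ c → a + c ≡ b → a ≤ b
≤-by-gap {a} c 0≤c a+c≡b = subst₂ _≤_ (+-identityʳ a) a+c≡b (+-monoʳ-≤ a 0≤c)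

<-by-gap : ∀ {a b} c → 0ℚ ℚ.< c → a + c ≡ b → a ℚ.< b
<-by-gap {a} c 0<c a+c≡b = subst₂ ℚ._<_ (+-identityʳ a) a+c≡b (+-monoʳ-< a 0<c)

gap-nonNeg : ∀ {a b} → a ≤ b → 0ℚ ≤ b - a
gap-nonNeg {a} {b} a≤b = subst (_≤ b - a) (+-inverseʳ a) (+-monoˡ-≤ (- a) a≤b)

gap-pos : ∀ {a b} → a ℚ.< b → 0ℚ ℚ.< b - a
gap-pos {a} {b} a<b = subst (ℚ._< b - a) (+-inverseʳ a) (+-monoˡ-< (- a) a<b)

nonNeg-+ : ∀ {a b} → 0ℚ ≤ a → 0ℚ ≤ b → 0ℚ ≤ a + b
nonNeg-+ 0≤a 0≤b = ≤-trans 0≤a (≤-by-gap _ 0≤b refl)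

nonNeg-* : ∀ {a b} → 0ℚ ≤ a → 0ℚ ≤ b → 0ℚ ≤ a · b
nonNeg-* {a} {b} 0≤a 0≤b =
  nonNegative⁻¹ (a · b) {{nonNeg*nonNeg⇒nonNeg a {{ℚ.nonNegative 0≤a}} b {{ℚ.nonNegative 0≤b}}}}

pos-* : ∀ {a b} → 0ℚ ℚ.< a → 0ℚ ℚ.< b → 0ℚ ℚ.< a · b
pos-* {a} {b} 0<a 0<b = positive⁻¹ (a · b) {{pos*pos⇒pos a {{ℚ.positive 0<a}} b {{ℚ.positive 0<b}}}}

square-nonNeg : ∀ a → 0ℚ ≤ a · a
square-nonNeg a with ≤-total 0ℚ a
... | inj₁ 0≤a = nonNeg-* 0≤a 0≤a
... | inj₂ a≤0 = subst (0ℚ ≤_) (solve 1 (λ a → (con 0ℚ :- a) :* (con 0ℚ :- a) := a :* a) refl a)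
                   (nonNeg-* (gap-nonNeg a≤0) (gap-nonNeg a≤0))

*-mono-nonNeg : ∀ {a b c d} → 0ℚ ≤ a → a ≤ b → 0ℚ ≤ c → c ≤ d → a · c ≤ b · d
*-mono-nonNeg {a} {b} {c} {d} 0≤a a≤b 0≤c c≤d =
  ≤-by-gap ((b - a) · d + a · (d - c))
    (nonNeg-+ (nonNeg-* (gap-nonNeg a≤b) (≤-trans 0≤c c≤d)) (nonNeg-* 0≤a (gap-nonNeg c≤d)))
    (solve 4 (λ a b c d → a :* c :+ ((b :- a) :* d :+ a :* (d :- c)) := b :* d) refl a b c d)

≤-from-squares : ∀ {a b} → 0ℚ ≤ b → a · a ≤ b · b → a ≤ b
≤-from-squares {a} {b} 0≤b a²≤b² with a ≤? b
... | yes a≤b = a≤b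
... | no a≰b = contradiction (≤-<-trans a²≤b² b²<a²) (<-irrefl refl)
  where
  b<a : b ℚ.< a
  b<a = ≰⇒> a≰b
  b²<a² : b · b ℚ.< a · a
  b²<a² = <-by-gap ((a - b) · (a + b))
    (pos-* (gap-pos b<a) (<-≤-trans (≤-<-trans 0≤b b<a) (≤-by-gap b 0≤b refl)))
    (solve 2 (λ a b → b :* b :+ (a :- b) :* (a :+ b) := a :* a) refl a b)

open SemiringSum (Ring.semiring +-*-ring) using (∑-distrib-+; ∑-comm; *-distribˡ-sum; *-distribʳ-sum)
  renaming (sum to ∑; sum-cong-≗ to ∑-cong; sum-replicate-zero to ∑-zero)
open SemiringSum ℕ.+-*-semiring using ()
  renaming (sum to ∑ℕ; sum-cong-≗ to ∑ℕ-cong; sum-replicate-zero to ∑ℕ-zero; ∑-distrib-+ to ∑ℕ-distrib-+; ∑-comm to ∑ℕ-comm)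

ι-∑ : ∀ {k} (m : Fin k → ℕ) → ι (∑ℕ m) ≡ ∑ (ι ∘ m)
ι-∑ {zero} m = refl
ι-∑ {suc k} m = ≡.trans (ι-+ (m zero) (∑ℕ (m ∘ suc))) (cong (ι (m zero) +_) (ι-∑ (m ∘ suc)))

∑-mono : ∀ {k} {f g : Fin k → ℚ} → (∀ i → f i ≤ g i) → ∑ f ≤ ∑ g
∑-mono {zero} f≤g = ≤-refl
∑-mono {suc k} f≤g = +-mono-≤ (f≤g zero) (∑-mono (f≤g ∘ suc))

∑-nonNeg : ∀ {k} {f : Fin k → ℚ} → (∀ i → 0ℚ ≤ f i) → 0ℚ ≤ ∑ f
∑-nonNeg {zero} 0≤f = ≤-refl
∑-nonNeg {suc k} 0≤f = nonNeg-+ (0≤f zero) (∑-nonNeg (0≤f ∘ suc))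

∑-mono-< : ∀ {k} {f g : Fin k → ℚ} → (∀ i → f i ≤ g i) → (i : Fin k) → f i ℚ.< g i → ∑ f ℚ.< ∑ g
∑-mono-< f≤g zero fi<gi = +-mono-<-≤ fi<gi (∑-mono (f≤g ∘ suc))
∑-mono-< f≤g (suc i) fi<gi = +-mono-≤-< (f≤g zero) (∑-mono-< (f≤g ∘ suc) i fi<gi)

∑ℕ-positive : ∀ {k} (m : Fin k → ℕ) → 0 ℕ.< ∑ℕ m → ∃ λ i → 0 ℕ.< m i
∑ℕ-positive {suc k} m 0<∑ with m zero in eq
... | suc _ = zero , subst (0 ℕ.<_) (≡.sym eq) (ℕ.s≤s ℕ.z≤n)
... | zero with ∑ℕ-positive (m ∘ suc) 0<∑
...   | i , 0<mi = suc i , 0<mi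

δ : ∀ {k} → Fin k → Fin k → ℚ
δ zero    zero    = 1ℚ
δ zero    (suc _) = 0ℚ
δ (suc _) zero    = 0ℚ
δ (suc i) (suc j) = δ i j

δ-diag : ∀ {k} (i : Fin k) → δ i i ≡ 1ℚ
δ-diag zero = refl
δ-diag (suc i) = δ-diag i

δ-off : ∀ {k} {i j : Fin k} → i ≢ j → δ i j ≡ 0ℚ
δ-off {i = zero}  {zero}  i≢j = contradiction refl i≢j
δ-off {i = zero}  {suc _} _   = refl
δ-off {i = suc _} {zero}  _   = refl
δ-off {i = suc i} {suc j} i≢j = δ-off (i≢j ∘ cong suc)

∑-δ : ∀ {k} (i : Fin k) (f : Fin k → ℚ) → ∑ (λ j → f j · δ i j) ≡ f i
∑-δ {suc k} zero f = begin
    f zero · 1ℚ + ∑ (λ j → f (suc j) · 0ℚ)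
  ≡⟨ cong₂ _+_ (*-identityʳ (f zero)) (∑-cong (λ j → *-zeroʳ (f (suc j)))) ⟩
    f zero + ∑ {k} (λ _ → 0ℚ)
  ≡⟨ cong (f zero +_) (∑-zero k) ⟩
    f zero + 0ℚ
  ≡⟨ +-identityʳ (f zero) ⟩
    f zero
  ∎
  where open ≡-Reasoning
∑-δ {suc k} (suc i) f = ≡.trans (cong (_+ ∑ (λ j → f (suc j) · δ i j)) (*-zeroʳ (f zero)))
                                (≡.trans (+-identityˡ _) (∑-δ i (f ∘ suc)))

∑-product : ∀ {k l} (f : Fin k → ℚ) (g : Fin l → ℚ) → ∑ f · ∑ g ≡ ∑ (λ i → ∑ (λ j → f i · g j))
∑-product f g = ≡.trans (*-distribʳ-sum (∑ g) f) (∑-cong (λ i → *-distribˡ-sum (f i) g))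

two : ℚ
two = ι 2

am-gm-pair : ∀ {x s x' s' p} → 0ℚ ≤ x → 0ℚ ≤ s → 0ℚ ≤ x' → 0ℚ ≤ s' → 0ℚ ≤ p → s · s' ≤ p · p →
             two · ((x · s) · (x' · s')) ≤ ((x · s) · x + (x' · s') · x') · p
am-gm-pair {x} {s} {x'} {s'} {p} 0≤x 0≤s 0≤x' 0≤s' 0≤p ss'≤p² =
  ≤-from-squares (nonNeg-* (nonNeg-+ 0≤X 0≤Y) 0≤p) (begin
    (two · ((x · s) · (x' · s'))) · (two · ((x · s) · (x' · s')))
  ≡⟨ solve 4 (λ x s x' s' → (con two :* ((x :* s) :* (x' :* s'))) :* (con two :* ((x :* s) :* (x' :* s')))
                := (con (ι 4) :* (((x :* s) :* x) :* ((x' :* s') :* x'))) :* (s :* s')) refl x s x' s' ⟩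
    (ι 4 · (X · Y)) · (s · s')
  ≤⟨ *-mono-nonNeg (nonNeg-* (ι-nonNeg 4) (nonNeg-* 0≤X 0≤Y)) four-XY≤ (nonNeg-* 0≤s 0≤s') ss'≤p² ⟩
    ((X + Y) · (X + Y)) · (p · p)
  ≡⟨ solve 3 (λ X Y p → ((X :+ Y) :* (X :+ Y)) :* (p :* p) := ((X :+ Y) :* p) :* ((X :+ Y) :* p)) refl X Y p ⟩
    ((X + Y) · p) · ((X + Y) · p)
  ∎)
  where
  open ≤-Reasoning
  X Y : ℚ
  X = (x · s) · x
  Y = (x' · s') · x'
  0≤X : 0ℚ ≤ X
  0≤X = nonNeg-* (nonNeg-* 0≤x 0≤s) 0≤x
  0≤Y : 0ℚ ≤ Y
  0≤Y = nonNeg-* (nonNeg-* 0≤x' 0≤s') 0≤x'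
  four-XY≤ : ι 4 · (X · Y) ≤ (X + Y) · (X + Y)
  four-XY≤ = ≤-by-gap ((X - Y) · (X - Y)) (square-nonNeg (X - Y))
    (solve 2 (λ X Y → con (ι 4) :* (X :* Y) :+ (X :- Y) :* (X :- Y) := (X :+ Y) :* (X :+ Y)) refl X Y)

-- Proof: bound every 2 m i m j by  2 m i m j δ i j + a i p i j + a j p j i
-- (a = m x) and sum; the two cross sums coincide after exchanging indices.
weighted-am-gm : ∀ {k} (m x s : Fin k → ℚ) (p : Fin k → Fin k → ℚ) →
  (∀ i → 0ℚ ≤ x i) → (∀ i → 0ℚ ≤ s i) → (∀ i → x i · s i ≡ m i) →
  (∀ i j → 0ℚ ≤ p i j) → (∀ i j → p i j ≡ p j i) →
  (∀ i j → i ≢ j → s i · s j ≤ p i j · p i j) →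
  ∑ m · ∑ m ≤ ∑ (λ i → m i · (m i + x i · ∑ (p i)))
weighted-am-gm {k} m x s p 0≤x 0≤s xs≡m 0≤p p-sym ss≤p² = *-cancelˡ-≤-pos two doubled
  where
  a : Fin k → ℚ
  a i = m i · x i
  bound : Fin k → Fin k → ℚ
  bound i j = two · (m i · m j) · δ i j + (a i · p i j + a j · p j i)

  0≤a : ∀ i → 0ℚ ≤ a i
  0≤a i = subst (λ z → 0ℚ ≤ z · x i) (xs≡m i) (nonNeg-* (nonNeg-* (0≤x i) (0≤s i)) (0≤x i))

  two-inside : (f : Fin k → Fin k → ℚ) → two · ∑ (λ i → ∑ (λ j → f i j)) ≡ ∑ (λ i → ∑ (λ j → two · f i j))
  two-inside f = ≡.trans (*-distribˡ-sum two (λ i → ∑ (f i))) (∑-cong (λ i → *-distribˡ-sum two (f i)))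

  -- On the diagonal the bound is trivial; off it, it is am-gm-pair.
  term-bound : ∀ i j → two · (m i · m j) ≤ bound i j
  term-bound i j with i ≟ j
  ... | yes refl = ≤-by-gap (a i · p i i + a i · p i i) (nonNeg-+ a·p≥0 a·p≥0)
        (cong (_+ (a i · p i i + a i · p i i)) (≡.trans (≡.sym (*-identityʳ (two · (m i · m i)))) (cong (two · (m i · m i) ·_) (≡.sym (δ-diag i)))))
    where
    a·p≥0 : 0ℚ ≤ a i · p i i
    a·p≥0 = nonNeg-* (0≤a i) (0≤p i i)
  ... | no i≢j = subst₂ _≤_ (cong₂ (λ u v → two · (u · v)) (xs≡m i) (xs≡m j)) off-diagonal
        (am-gm-pair (0≤x i) (0≤s i) (0≤x j) (0≤s j) (0≤p i j) (ss≤p² i j i≢j))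
    where
    off-diagonal : ((x i · s i) · x i + (x j · s j) · x j) · p i j ≡ bound i j
    off-diagonal = begin
        ((x i · s i) · x i + (x j · s j) · x j) · p i j
      ≡⟨ cong₂ (λ u v → (u · x i + v · x j) · p i j) (xs≡m i) (xs≡m j) ⟩
        (a i + a j) · p i j
      ≡⟨ solve 4 (λ c ai aj q → (ai :+ aj) :* q := c :* con 0ℚ :+ (ai :* q :+ aj :* q)) refl (two · (m i · m j)) (a i) (a j) (p i j) ⟩
        two · (m i · m j) · 0ℚ + (a i · p i j + a j · p i j)
      ≡⟨ cong₂ (λ d q → two · (m i · m j) · d + (a i · p i j + a j · q)) (≡.sym (δ-off i≢j)) (p-sym i j) ⟩
        bound i j
      ∎
      where open ≡-Reasoning

  row-sum : ∀ i → ∑ (λ j → bound i j) ≡ (two · (m i · m i) + ∑ (λ j → a i · p i j)) + ∑ (λ j → a j · p j i)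
  row-sum i = begin
      ∑ (λ j → bound i j)
    ≡⟨ ∑-distrib-+ (λ j → two · (m i · m j) · δ i j) (λ j → a i · p i j + a j · p j i) ⟩
      ∑ (λ j → two · (m i · m j) · δ i j) + ∑ (λ j → a i · p i j + a j · p j i)
    ≡⟨ cong₂ _+_ (∑-δ i (λ j → two · (m i · m j))) (∑-distrib-+ (λ j → a i · p i j) (λ j → a j · p j i)) ⟩
      two · (m i · m i) + (∑ (λ j → a i · p i j) + ∑ (λ j → a j · p j i))
    ≡⟨ ≡.sym (+-assoc (two · (m i · m i)) (∑ (λ j → a i · p i j)) (∑ (λ j → a j · p j i))) ⟩
      (two · (m i · m i) + ∑ (λ j → a i · p i j)) + ∑ (λ j → a j · p j i)
    ∎
    where open ≡-Reasoning

  regroup : ∀ mi xi P S → S ≡ (mi · xi) · P → (two · (mi · mi) + S) + S ≡ two · (mi · (mi + xi · P))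
  regroup mi xi P S refl = solve 3 (λ mi xi P → (con two :* (mi :* mi) :+ (mi :* xi) :* P) :+ (mi :* xi) :* P
                                           := con two :* (mi :* (mi :+ xi :* P))) refl mi xi P

  doubled : two · (∑ m · ∑ m) ≤ two · ∑ (λ i → m i · (m i + x i · ∑ (p i)))
  doubled = begin
      two · (∑ m · ∑ m)
    ≡⟨ ≡.trans (cong (two ·_) (∑-product m m)) (two-inside (λ i j → m i · m j)) ⟩
      ∑ (λ i → ∑ (λ j → two · (m i · m j)))
    ≤⟨ ∑-mono (λ i → ∑-mono (λ j → term-bound i j)) ⟩
      ∑ (λ i → ∑ (λ j → bound i j))
    ≡⟨ ∑-cong row-sum ⟩
      ∑ (λ i → (two · (m i · m i) + ∑ (λ j → a i · p i j)) + ∑ (λ j → a j · p j i))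
    ≡⟨ ∑-distrib-+ (λ i → two · (m i · m i) + ∑ (λ j → a i · p i j)) (λ i → ∑ (λ j → a j · p j i)) ⟩
      ∑ (λ i → two · (m i · m i) + ∑ (λ j → a i · p i j)) + ∑ (λ i → ∑ (λ j → a j · p j i))
    ≡⟨ cong (∑ (λ i → two · (m i · m i) + ∑ (λ j → a i · p i j)) +_) (∑-comm (λ i j → a j · p j i)) ⟩
      ∑ (λ i → two · (m i · m i) + ∑ (λ j → a i · p i j)) + ∑ (λ i → ∑ (λ j → a i · p i j))
    ≡⟨ ≡.sym (∑-distrib-+ (λ i → two · (m i · m i) + ∑ (λ j → a i · p i j)) (λ i → ∑ (λ j → a i · p i j))) ⟩
      ∑ (λ i → (two · (m i · m i) + ∑ (λ j → a i · p i j)) + ∑ (λ j → a i · p i j))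
    ≡⟨ ∑-cong (λ i → regroup (m i) (x i) (∑ (p i)) _
                       (≡.sym (*-distribˡ-sum (a i) (p i)))) ⟩
      ∑ (λ i → two · (m i · (m i + x i · ∑ (p i))))
    ≡⟨ ≡.sym (*-distribˡ-sum two (λ i → m i · (m i + x i · ∑ (p i)))) ⟩
      two · ∑ (λ i → m i · (m i + x i · ∑ (p i)))
    ∎
    where open ≤-Reasoning

averaging : ∀ {k} (w : Fin k → ℕ) (v : Fin k → ℚ) (c : ℚ) → 0 ℕ.< ∑ℕ w →
            ∑ (λ i → ι (w i) · c) ≤ ∑ (λ i → ι (w i) · v i) → ∃ λ i → 0 ℕ.< w i × c ≤ v i
averaging w v c 0<∑w wc≤wv with any? (λ i → (0 ℕ.<? w i) ×-dec (c ≤? v i))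
... | yes found = found
... | no none = contradiction (≤-<-trans wc≤wv wv<wc) (<-irrefl refl)
  where
  below : ∀ i → 0 ℕ.< w i → v i ℚ.< c
  below i 0<wi = ≰⇒> (λ c≤vi → none (i , 0<wi , c≤vi))
  pointwise : ∀ i → ι (w i) · v i ≤ ι (w i) · c
  pointwise i with 0 ℕ.<? w i
  ... | yes 0<wi = *-monoˡ-≤-nonNeg (ι (w i)) {{ℚ.nonNegative (ι-nonNeg (w i))}} (<⇒≤ (below i 0<wi))
  ... | no 0≮wi rewrite ℕ.n≤0⇒n≡0 (ℕ.≮⇒≥ 0≮wi) = ≤-reflexive (≡.trans (*-zeroˡ (v i)) (≡.sym (*-zeroˡ c)))
  wv<wc : ∑ (λ i → ι (w i) · v i) ℚ.< ∑ (λ i → ι (w i) · c)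
  wv<wc with ∑ℕ-positive w 0<∑w
  ... | i , 0<wi = ∑-mono-< pointwise i
                     (*-monoʳ-<-pos (ι (w i)) {{ℚ.positive (ι-pos 0<wi)}} (below i 0<wi))

share : ∀ {m u} {s} → m ℕ.≤ u → ι u ≤ s → ∃ λ x → 0ℚ ≤ x × x ≤ 1ℚ × x · s ≡ ι m
share {m} {u} {s} m≤u u≤s with 0ℚ <? s
... | yes 0<s = x , nonNeg-* (ι-nonNeg m) (<⇒≤ (positive⁻¹ (1/ s) {{1/pos⇒pos s}})) , x≤1 , xs≡m
  where
  instance
    _ : ℚ.Positive s
    _ = ℚ.positive 0<s
    _ : ℚ.NonZero s
    _ = pos⇒nonZero s
  x : ℚ
  x = ι m · 1/ s
  xs≡m : x · s ≡ ι m
  xs≡m = ≡.trans (*-assoc (ι m) (1/ s) s) (≡.trans (cong (ι m ·_) (*-inverseˡ s)) (*-identityʳ (ι m)))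
  x≤1 : x ≤ 1ℚ
  x≤1 = *-cancelʳ-≤-pos s (subst₂ _≤_ (≡.sym xs≡m) (≡.sym (*-identityˡ s)) (≤-trans (ι-mono m≤u) u≤s))
... | no 0≮s = 0ℚ , ≤-refl , 0≤1 , ≡.trans (*-zeroˡ s) (≡.sym m≡0)
  where
  m≡0 : ι m ≡ 0ℚ
  m≡0 = ≤-antisym (≤-trans (ι-mono m≤u) (≤-trans u≤s (≮⇒≥ 0≮s))) (ι-nonNeg m)

∑-linear : ∀ {k} (f g : Fin k → ℚ) (c : ℚ) → ∑ (λ j → f j - c · g j) ≡ ∑ f - c · ∑ g
∑-linear f g c = begin
    ∑ (λ j → f j - c · g j)
  ≡⟨ ∑-cong (λ j → solve 3 (λ f c g → f :- c :* g := f :+ (:- c) :* g) refl (f j) c (g j)) ⟩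
    ∑ (λ j → f j + (- c) · g j)
  ≡⟨ ∑-distrib-+ f (λ j → (- c) · g j) ⟩
    ∑ f + ∑ (λ j → (- c) · g j)
  ≡⟨ cong (∑ f +_) (≡.sym (*-distribˡ-sum (- c) g)) ⟩
    ∑ f + (- c) · ∑ g
  ≡⟨ solve 3 (λ F c G → F :+ (:- c) :* G := F :- c :* G) refl (∑ f) c (∑ g) ⟩
    ∑ f - c · ∑ g
  ∎
  where open ≡-Reasoning

∑-δ₁ : ∀ {k} (i : Fin k) → ∑ (δ i) ≡ 1ℚ
∑-δ₁ i = ≡.trans (∑-cong (λ j → ≡.sym (*-identityˡ (δ i j)))) (∑-δ i (λ _ → 1ℚ))

∑-damp : ∀ {k} (i : Fin k) (d : ℚ) (f : Fin k → ℚ) → ∑ (λ l → (1ℚ - d · δ i l) · f l) ≡ ∑ f - d · f i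
∑-damp i d f = begin
    ∑ (λ l → (1ℚ - d · δ i l) · f l)
  ≡⟨ ∑-cong (λ l → solve 3 (λ d e f → (con 1ℚ :- d :* e) :* f := f :- d :* (f :* e)) refl d (δ i l) (f l)) ⟩
    ∑ (λ l → f l - d · (f l · δ i l))
  ≡⟨ ∑-linear f (λ l → f l · δ i l) d ⟩
    ∑ f - d · ∑ (λ l → f l · δ i l)
  ≡⟨ cong (λ z → ∑ f - d · z) (∑-δ i f) ⟩
    ∑ f - d · f i
  ∎
  where open ≡-Reasoning

record Certificate {k} (u : Fin k → ℕ) (s : Fin k → ℚ) (p : Fin k → Fin k → ℚ) : Set where
  field
    covers        : ∀ i → ι (u i) ≤ s i
    weight-nonNeg : ∀ i j → 0ℚ ≤ p i j
    symmetric     : ∀ i j → p i j ≡ p j i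
    diagonal      : ∀ i → p i i ≡ 0ℚ
    geometric     : ∀ i j → i ≢ j → s i · s j ≤ p i j · p i j

  budget-nonNeg : ∀ i → 0ℚ ≤ s i
  budget-nonNeg i = ≤-trans (ι-nonNeg (u i)) (covers i)

-- The potential: total budget plus total pair weight (each pair counted twice).
Φ : ∀ {k} → (Fin k → ℚ) → (Fin k → Fin k → ℚ) → ℚ
Φ s p = ∑ s + ∑ (λ i → ∑ (p i))

Φ-nonNeg : ∀ {k} {u : Fin k → ℕ} {s p} → Certificate u s p → 0ℚ ≤ Φ s p
Φ-nonNeg C = nonNeg-+ (∑-nonNeg budget-nonNeg) (∑-nonNeg (λ i → ∑-nonNeg (weight-nonNeg i)))
  where open Certificate C

record Answer {k} (u m : Fin k → ℕ) (s : Fin k → ℚ) (p : Fin k → Fin k → ℚ) : Set where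
  field
    class   : Fin k
    nonzero : 0 ℕ.< m class
    budget  : Fin k → ℚ
    weight  : Fin k → Fin k → ℚ
    -- the new data certify the class sizes after the marked part of class is colored
    next    : ∀ {u′} → u′ class ℕ.+ m class ≡ u class → (∀ j → class ≢ j → u′ j ≡ u j) → Certificate u′ budget weight
    -- and the potential pays for the score of the round
    drop    : ι (∑ℕ m) + Φ budget weight ≤ Φ s p

module Round {k} {u : Fin k → ℕ} {s : Fin k → ℚ} {p : Fin k → Fin k → ℚ}
             (C : Certificate u s p) (m : Fin k → ℕ) (m≤u : ∀ i → m i ℕ.≤ u i) where
  open Certificate C

  -- x i = m i / s i, the marked share of the budget of class i.
  x : Fin k → ℚ
  x i = proj₁ (share (m≤u i) (covers i))

  0≤x : ∀ i → 0ℚ ≤ x i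
  0≤x i = proj₁ (proj₂ (share (m≤u i) (covers i)))

  x≤1 : ∀ i → x i ≤ 1ℚ
  x≤1 i = proj₁ (proj₂ (proj₂ (share (m≤u i) (covers i))))

  xs≡m : ∀ i → x i · s i ≡ ι (m i)
  xs≡m i = proj₂ (proj₂ (proj₂ (share (m≤u i) (covers i))))

  price : Fin k → ℚ
  price i = ι (m i) + x i · ∑ (p i)

  -- Painter can color a nonempty marked class whose price is at least the score
  -- ∑ m of the round: by weighted AM–GM, (∑ m)² ≤ ∑ m i · price i.
  affordable : 0 ℕ.< ∑ℕ m → ∃ λ i → 0 ℕ.< m i × ι (∑ℕ m) ≤ price i
  affordable 0<∑m = subst (λ M → ∃ λ i → 0 ℕ.< m i × M ≤ price i) (≡.sym (ι-∑ m))
    (averaging m price (∑ (ι ∘ m)) 0<∑m (begin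
        ∑ (λ i → ι (m i) · ∑ (ι ∘ m))
      ≡⟨ ≡.sym (*-distribʳ-sum (∑ (ι ∘ m)) (ι ∘ m)) ⟩
        ∑ (ι ∘ m) · ∑ (ι ∘ m)
      ≤⟨ weighted-am-gm (ι ∘ m) x s p 0≤x budget-nonNeg xs≡m weight-nonNeg symmetric geometric ⟩
        ∑ (λ i → ι (m i) · price i)
      ∎))
    where open ≤-Reasoning

  module Coloring (i : Fin k) where
    d : ℚ
    d = x i · ½

    γ : Fin k → ℚ
    γ j = 1ℚ - d · δ i j

    s′ : Fin k → ℚ
    s′ j = s j - ι (m i) · δ i j

    p′ : Fin k → Fin k → ℚ
    p′ j l = γ j · (γ l · p j l)

    potential-drop : Φ s′ p′ + price i ≡ Φ s p
    potential-drop = begin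
        (∑ s′ + ∑ (λ j → ∑ (p′ j))) + price i
      ≡⟨ cong (λ z → (z + ∑ (λ j → ∑ (p′ j))) + price i)
              (≡.trans (∑-linear s (δ i) (ι (m i))) (cong (λ z → ∑ s - ι (m i) · z) (∑-δ₁ i))) ⟩
        ((∑ s - ι (m i) · 1ℚ) + ∑ (λ j → ∑ (p′ j))) + price i
      ≡⟨ cong (λ z → ((∑ s - ι (m i) · 1ℚ) + z) + price i) weights′ ⟩
        ((∑ s - ι (m i) · 1ℚ) + ((R - d · ∑ (p i)) - d · (∑ (p i) - d · 0ℚ))) + price i
      ≡⟨ solve 5 (λ S R mi xi P → ((S :- mi :* con 1ℚ) :+ ((R :- (xi :* con ½) :* P)
                                    :- (xi :* con ½) :* (P :- (xi :* con ½) :* con 0ℚ))) :+ (mi :+ xi :* P)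
                                  := S :+ R) refl (∑ s) R (ι (m i)) (x i) (∑ (p i)) ⟩
        ∑ s + R
      ∎
      where
      open ≡-Reasoning
      R : ℚ
      R = ∑ (λ j → ∑ (p j))
      column : ∑ (λ j → p j i) ≡ ∑ (p i)
      column = ∑-cong (λ j → symmetric j i)
      weights′ : ∑ (λ j → ∑ (p′ j)) ≡ (R - d · ∑ (p i)) - d · (∑ (p i) - d · 0ℚ)
      weights′ = begin
          ∑ (λ j → ∑ (λ l → γ j · (γ l · p j l)))
        ≡⟨ ∑-cong (λ j → ≡.trans (≡.sym (*-distribˡ-sum (γ j) (λ l → γ l · p j l))) (cong (γ j ·_) (∑-damp i d (p j)))) ⟩
          ∑ (λ j → γ j · (∑ (p j) - d · p j i))
        ≡⟨ ∑-damp i d (λ j → ∑ (p j) - d · p j i) ⟩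
          ∑ (λ j → ∑ (p j) - d · p j i) - d · (∑ (p i) - d · p i i)
        ≡⟨ cong₂ (λ a b → a - d · (∑ (p i) - d · b)) (≡.trans (∑-linear (λ j → ∑ (p j)) (λ j → p j i) d) (cong (λ z → R - d · z) column)) (diagonal i) ⟩
          (R - d · ∑ (p i)) - d · (∑ (p i) - d · 0ℚ)
        ∎

    0≤γ : ∀ j → 0ℚ ≤ γ j
    0≤γ j with i ≟ j
    ... | yes refl rewrite δ-diag i =
      subst (0ℚ ≤_) (solve 1 (λ x → (con 1ℚ :- x) :+ x :* con ½ := con 1ℚ :- x :* con ½ :* con 1ℚ) refl (x i))
            (nonNeg-+ (gap-nonNeg (x≤1 i)) (nonNeg-* (0≤x i) 0≤½))
    ... | no i≢j rewrite δ-off i≢j =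
      subst (0ℚ ≤_) (solve 1 (λ d → con 1ℚ := con 1ℚ :- d :* con 0ℚ) refl d) 0≤1

    -- The budget of class i shrinks to s i (1 - x i) ≤ s i (1 - x i / 2)².
    s′≤ : ∀ j → s′ j ≤ (γ j · γ j) · s j
    s′≤ j with i ≟ j
    ... | yes refl rewrite δ-diag i =
      ≤-by-gap ((d · d) · s i) (nonNeg-* (square-nonNeg d) (budget-nonNeg i))
        (≡.trans (cong (λ z → (s i - z · 1ℚ) + (d · d) · s i) (≡.sym (xs≡m i)))
          (solve 2 (λ x s → (s :- (x :* s) :* con 1ℚ) :+ ((x :* con ½) :* (x :* con ½)) :* s
                            := ((con 1ℚ :- (x :* con ½) :* con 1ℚ) :* (con 1ℚ :- (x :* con ½) :* con 1ℚ)) :* s) refl (x i) (s i)))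
    ... | no i≢j rewrite δ-off i≢j =
      ≤-reflexive (solve 3 (λ sj mi d → sj :- mi :* con 0ℚ := ((con 1ℚ :- d :* con 0ℚ) :* (con 1ℚ :- d :* con 0ℚ)) :* sj) refl (s j) (ι (m i)) d)

    certificate′ : ∀ {u′ : Fin k → ℕ} → u′ i ℕ.+ m i ≡ u i → (∀ j → i ≢ j → u′ j ≡ u j) → Certificate u′ s′ p′
    certificate′ {u′} colored untouched = record
      { covers        = covers′
      ; weight-nonNeg = λ j l → nonNeg-* (0≤γ j) (nonNeg-* (0≤γ l) (weight-nonNeg j l))
      ; symmetric     = λ j l → ≡.trans (cong (λ z → γ j · (γ l · z)) (symmetric j l))
                                  (solve 3 (λ a b c → a :* (b :* c) := b :* (a :* c)) refl (γ j) (γ l) (p l j))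
      ; diagonal      = λ j → ≡.trans (cong (λ z → γ j · (γ j · z)) (diagonal j))
                                  (solve 1 (λ g → g :* (g :* con 0ℚ) := con 0ℚ) refl (γ j))
      ; geometric     = geometric′
      }
      where
      covers′ : ∀ j → ι (u′ j) ≤ s′ j
      covers′ j with i ≟ j
      ... | yes refl rewrite δ-diag i = ≤-by-gap (s i - ι (u i)) (gap-nonNeg (covers i))
        (≡.trans (cong (λ z → ι (u′ i) + (s i - z)) (≡.trans (cong ι (≡.sym colored)) (ι-+ (u′ i) (m i))))
          (solve 3 (λ a s b → a :+ (s :- (a :+ b)) := s :- b :* con 1ℚ) refl (ι (u′ i)) (s i) (ι (m i))))
      ... | no i≢j rewrite δ-off i≢j | untouched j i≢j =
        ≤-trans (covers j) (≤-reflexive (solve 2 (λ s b → s := s :- b :* con 0ℚ) refl (s j) (ι (m i))))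

      0≤s′ : ∀ j → 0ℚ ≤ s′ j
      0≤s′ j = ≤-trans (ι-nonNeg (u′ j)) (covers′ j)

      geometric′ : ∀ j l → j ≢ l → s′ j · s′ l ≤ p′ j l · p′ j l
      geometric′ j l j≢l = begin
          s′ j · s′ l
        ≤⟨ *-mono-nonNeg (0≤s′ j) (s′≤ j) (0≤s′ l) (s′≤ l) ⟩
          ((γ j · γ j) · s j) · ((γ l · γ l) · s l)
        ≡⟨ solve 4 (λ a b c e → ((a :* a) :* c) :* ((b :* b) :* e) := ((a :* b) :* (a :* b)) :* (c :* e)) refl (γ j) (γ l) (s j) (s l) ⟩
          ((γ j · γ l) · (γ j · γ l)) · (s j · s l)
        ≤⟨ *-monoˡ-≤-nonNeg ((γ j · γ l) · (γ j · γ l)) {{ℚ.nonNegative (square-nonNeg (γ j · γ l))}} (geometric j l j≢l) ⟩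
          ((γ j · γ l) · (γ j · γ l)) · (p j l · p j l)
        ≡⟨ solve 3 (λ a b c → ((a :* b) :* (a :* b)) :* (c :* c) := (a :* (b :* c)) :* (a :* (b :* c))) refl (γ j) (γ l) (p j l) ⟩
          p′ j l · p′ j l
        ∎
        where open ≤-Reasoning

  painter-round : 0 ℕ.< ∑ℕ m → Answer u m s p
  painter-round 0<∑m with affordable 0<∑m
  ... | i , 0<mi , score≤price = record
    { class = i ; nonzero = 0<mi ; budget = s′ ; weight = p′ ; next = certificate′
    ; drop  = begin
        ι (∑ℕ m) + Φ s′ p′
      ≤⟨ +-monoˡ-≤ (Φ s′ p′) score≤price ⟩
        price i + Φ s′ p′
      ≡⟨ ≡.trans (+-comm (price i) (Φ s′ p′)) potential-drop ⟩
        Φ s p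
      ∎
    }
    where
    open Coloring i
    open ≤-Reasoning

𝟙 : Bool → ℕ
𝟙 true = 1
𝟙 false = 0

lookup-minus : ∀ {n} (U X : VSet n) (v : Fin n) → lookup (minus U X) v ≡ lookup U v ∧ not (lookup X v)
lookup-minus (_ ∷ _) (_ ∷ _) zero = refl
lookup-minus (_ ∷ U) (_ ∷ X) (suc v) = lookup-minus U X v

isSub⇒⊆ : ∀ {n} (M U : VSet n) → isSub M U ≡ true → ∀ v → lookup M v ≡ true → lookup U v ≡ true
isSub⇒⊆ (true  ∷ M) (true  ∷ U) M⊆U zero    _  = refl
isSub⇒⊆ (true  ∷ M) (false ∷ U) ()  _       _
isSub⇒⊆ (false ∷ M) (_     ∷ U) M⊆U zero    ()
isSub⇒⊆ (true  ∷ M) (true  ∷ U) M⊆U (suc v) Mv = isSub⇒⊆ M U M⊆U v Mv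
isSub⇒⊆ (false ∷ M) (_     ∷ U) M⊆U (suc v) Mv = isSub⇒⊆ M U M⊆U v Mv

⊆⇒isSub : ∀ {n} (X M : VSet n) → (∀ v → lookup X v ≡ true → lookup M v ≡ true) → isSub X M ≡ true
⊆⇒isSub [] [] _ = refl
⊆⇒isSub (true  ∷ X) (true  ∷ M) X⊆M = ⊆⇒isSub X M (X⊆M ∘ suc)
⊆⇒isSub (true  ∷ X) (false ∷ M) X⊆M = contradiction (X⊆M zero refl) λ ()
⊆⇒isSub (false ∷ X) (_     ∷ M) X⊆M = ⊆⇒isSub X M (X⊆M ∘ suc)

nonempty-witness : ∀ {n} (X : VSet n) (v : Fin n) → lookup X v ≡ true → nonempty X ≡ true
nonempty-witness (true  ∷ X) _       _  = refl
nonempty-witness (false ∷ X) (suc v) Xv = nonempty-witness X v Xv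

size-∑ : ∀ {n} (X : VSet n) → size X ≡ ∑ℕ (λ v → 𝟙 (lookup X v))
size-∑ [] = refl
size-∑ (true  ∷ X) = cong suc (size-∑ X)
size-∑ (false ∷ X) = size-∑ X

nonempty⇒size-pos : ∀ {n} (X : VSet n) → nonempty X ≡ true → 0 ℕ.< size X
nonempty⇒size-pos (true  ∷ X) _ = ℕ.s≤s ℕ.z≤n
nonempty⇒size-pos (false ∷ X) X≠∅ = nonempty⇒size-pos X X≠∅

allᵇ-true : ∀ {A : Set} {p : A → Bool} (xs : List A) → (∀ x → p x ≡ true) → allᵇ p xs ≡ true
allᵇ-true [] _ = refl
allᵇ-true (x ∷ xs) all = cong₂ _∧_ (all x) (allᵇ-true xs all)

size-full : ∀ n → size (replicate n true) ≡ n
size-full zero = refl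
size-full (suc n) = cong suc (size-full n)

module Classes {n k : ℕ} (part : Fin n → Fin k) where

  count : VSet n → Fin k → ℕ
  count U i = ∑ℕ (λ v → 𝟙 (lookup U v ∧ ⌊ part v ≟ i ⌋))

  restrict : VSet n → Fin k → VSet n
  restrict M i = tabulate (λ v → lookup M v ∧ ⌊ part v ≟ i ⌋)

  lookup-restrict : ∀ M i v → lookup (restrict M i) v ≡ lookup M v ∧ ⌊ part v ≟ i ⌋
  lookup-restrict M i = lookup∘tabulate (λ v → lookup M v ∧ ⌊ part v ≟ i ⌋)

  count-colored : ∀ U M i → isSub M U ≡ true → count (minus U (restrict M i)) i ℕ.+ count M i ≡ count U i
  count-colored U M i M⊆U =
    ≡.trans (≡.sym (∑ℕ-distrib-+ (λ v → 𝟙 (lookup (minus U (restrict M i)) v ∧ ⌊ part v ≟ i ⌋)) (λ v → 𝟙 (lookup M v ∧ ⌊ part v ≟ i ⌋))))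
            (∑ℕ-cong pointwise)
    where
    split : ∀ u b e → (b ≡ true → u ≡ true) → 𝟙 ((u ∧ not (b ∧ e)) ∧ e) ℕ.+ 𝟙 (b ∧ e) ≡ 𝟙 (u ∧ e)
    split false false _     _ = refl
    split false true  _     h = contradiction (h refl) λ ()
    split true  true  true  _ = refl
    split true  true  false _ = refl
    split true  false true  _ = refl
    split true  false false _ = refl
    pointwise : ∀ v → 𝟙 (lookup (minus U (restrict M i)) v ∧ ⌊ part v ≟ i ⌋) ℕ.+ 𝟙 (lookup M v ∧ ⌊ part v ≟ i ⌋)
                      ≡ 𝟙 (lookup U v ∧ ⌊ part v ≟ i ⌋)
    pointwise v rewrite lookup-minus U (restrict M i) v | lookup-restrict M i v =
      split (lookup U v) (lookup M v) ⌊ part v ≟ i ⌋ (isSub⇒⊆ M U M⊆U v)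

  count-untouched : ∀ U M {i j} → i ≢ j → count (minus U (restrict M i)) j ≡ count U j
  count-untouched U M {i} {j} i≢j = ∑ℕ-cong pointwise
    where
    keep : ∀ u b e e′ → (e′ ≡ true → e ≡ false) → 𝟙 ((u ∧ not (b ∧ e)) ∧ e′) ≡ 𝟙 (u ∧ e′)
    keep false _     _     _     _ = refl
    keep true  false _     _     _ = refl
    keep true  true  false _     _ = refl
    keep true  true  true  false _ = refl
    keep true  true  true  true  h = contradiction (h refl) λ ()
    disjoint : ∀ a → ⌊ a ≟ j ⌋ ≡ true → ⌊ a ≟ i ⌋ ≡ false
    disjoint a a≟j with a ≟ i | a ≟ j
    ... | no _     | _       = refl
    ... | yes refl | yes a≡j = contradiction a≡j i≢j
    ... | yes _    | no _    = contradiction a≟j λ ()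
    pointwise : ∀ v → 𝟙 (lookup (minus U (restrict M i)) v ∧ ⌊ part v ≟ j ⌋) ≡ 𝟙 (lookup U v ∧ ⌊ part v ≟ j ⌋)
    pointwise v rewrite lookup-minus U (restrict M i) v | lookup-restrict M i v =
      keep (lookup U v) (lookup M v) ⌊ part v ≟ i ⌋ ⌊ part v ≟ j ⌋ (disjoint (part v))

  count-mono : ∀ U M i → isSub M U ≡ true → count M i ℕ.≤ count U i
  count-mono U M i M⊆U = subst (count M i ℕ.≤_) (count-colored U M i M⊆U) (ℕ.m≤n+m _ _)

  restrict-⊆ : ∀ M i → isSub (restrict M i) M ≡ true
  restrict-⊆ M i = ⊆⇒isSub (restrict M i) M λ v Xv →
    ∧-conicalˡ (lookup M v) _ (≡.trans (≡.sym (lookup-restrict M i v)) Xv)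

  restrict-class : ∀ M i v → lookup (restrict M i) v ≡ true → part v ≡ i
  restrict-class M i v Xv with part v ≟ i | ∧-conicalʳ (lookup M v) _ (≡.trans (≡.sym (lookup-restrict M i v)) Xv)
  ... | yes pv≡i | _ = pv≡i
  ... | no _     | ()

  restrict-independent : ∀ M i → independent (completeMultipartite part) (restrict M i) ≡ true
  restrict-independent M i = allᵇ-true (allFin n) (λ u → allᵇ-true (allFin n) (λ v → no-edge (lookup X u) (lookup X v) (part u ≟ part v)
    (λ Xu Xv → ≡.trans (restrict-class M i u Xu) (≡.sym (restrict-class M i v Xv)))))
    where
    X : VSet n
    X = restrict M i
    no-edge : ∀ a b {P : Set} (same? : Dec P) → (a ≡ true → b ≡ true → P) → not (a ∧ b ∧ not ⌊ same? ⌋) ≡ true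
    no-edge false _     _ _ = refl
    no-edge true  false _ _ = refl
    no-edge true  true  (yes _) _ = refl
    no-edge true  true  (no ¬P) same = contradiction (same refl refl) ¬P

  restrict-nonempty : ∀ M i → 0 ℕ.< count M i → nonempty (restrict M i) ≡ true
  restrict-nonempty M i 0<count with ∑ℕ-positive (λ v → 𝟙 (lookup M v ∧ ⌊ part v ≟ i ⌋)) 0<count
  ... | v , 0<𝟙 = nonempty-witness (restrict M i) v
        (≡.trans (lookup-restrict M i v) (𝟙-pos _ 0<𝟙))
    where
    𝟙-pos : ∀ b → 0 ℕ.< 𝟙 b → b ≡ true
    𝟙-pos true _ = refl

  -- Every vertex lies in exactly one class.
  size-by-classes : ∀ U → size U ≡ ∑ℕ (count U)
  size-by-classes U = begin
      size U
    ≡⟨ size-∑ U ⟩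
      ∑ℕ (λ v → 𝟙 (lookup U v))
    ≡⟨ ∑ℕ-cong (λ v → ≡.sym (one-class (lookup U v) (part v))) ⟩
      ∑ℕ (λ v → ∑ℕ (λ i → 𝟙 (lookup U v ∧ ⌊ part v ≟ i ⌋)))
    ≡⟨ ∑ℕ-comm (λ v i → 𝟙 (lookup U v ∧ ⌊ part v ≟ i ⌋)) ⟩
      ∑ℕ (count U)
    ∎
    where
    open ≡-Reasoning
    one-class : ∀ {l} b (a : Fin l) → ∑ℕ (λ i → 𝟙 (b ∧ ⌊ a ≟ i ⌋)) ≡ 𝟙 b
    one-class {l} false _ = ∑ℕ-zero l
    one-class {suc l} true zero = cong suc (∑ℕ-zero l)
    one-class {suc l} true (suc a) = ≡.trans (∑ℕ-cong (λ j → cong 𝟙 (⌊⌋-map′ _ _ (a ≟ j)))) (one-class true a)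

  count-full : ∀ i → count (replicate n true) i ≡ partSize part i
  count-full i = ≡.trans (∑ℕ-cong (λ v → cong (λ b → 𝟙 (b ∧ ⌊ part v ≟ i ⌋)) (lookup-replicate v true)))
                         (≡.sym (length-filterᵇ (λ v → ⌊ part v ≟ i ⌋) id))
    where
    length-filterᵇ : ∀ {l} (P : Fin n → Bool) (g : Fin l → Fin n) → length (filterᵇ P (List.tabulate g)) ≡ ∑ℕ (λ v → 𝟙 (P (g v)))
    length-filterᵇ {zero} P g = refl
    length-filterᵇ {suc l} P g with P (g zero)
    ... | true  = cong suc (length-filterᵇ P (g ∘ suc))
    ... | false = length-filterᵇ P (g ∘ suc)

∈-allSubsets : ∀ {n} (X : VSet n) → X ∈ allSubsets n
∈-allSubsets [] = here refl
∈-allSubsets {suc n} (false ∷ X) = ∈-++⁺ˡ (∈-map⁺ (false ∷_) (∈-allSubsets X))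
∈-allSubsets {suc n} (true ∷ X) = ∈-++⁺ʳ (List.map (false ∷_) (allSubsets n)) (∈-map⁺ (true ∷_) (∈-allSubsets X))

∈-filterᵇ⁺ : ∀ {A : Set} (P : A → Bool) {x : A} {xs} → x ∈ xs → P x ≡ true → x ∈ filterᵇ P xs
∈-filterᵇ⁺ P x∈xs Px = ∈-filter⁺ (T? ∘ P) x∈xs (Equivalence.from T-≡ Px)

∈-filterᵇ⁻ : ∀ {A : Set} (P : A → Bool) {x : A} {xs} → x ∈ filterᵇ P xs → P x ≡ true
∈-filterᵇ⁻ P {xs = xs} x∈ = Equivalence.to T-≡ (proj₂ (∈-filter⁻ (T? ∘ P) {xs = xs} x∈))

minL≤ : ∀ {z} (zs : List ℕ) → z ∈ zs → minL zs ℕ.≤ z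
minL≤ (x ∷ xs) (here refl) = fold≤seed x xs
  where
  fold≤seed : ∀ x xs → List.foldr ℕ._⊓_ x xs ℕ.≤ x
  fold≤seed x [] = ℕ.≤-refl
  fold≤seed x (y ∷ ys) = ℕ.≤-trans (ℕ.m⊓n≤n y _) (fold≤seed x ys)
minL≤ (x ∷ xs) (there z∈xs) = fold≤member x xs z∈xs
  where
  fold≤member : ∀ {z} x xs → z ∈ xs → List.foldr ℕ._⊓_ x xs ℕ.≤ z
  fold≤member x (y ∷ ys) (here refl) = ℕ.m⊓n≤m y _
  fold≤member x (y ∷ ys) (there z∈ys) = ℕ.≤-trans (ℕ.m⊓n≤n y _) (fold≤member x ys z∈ys)

maxL-attained : ∀ (zs : List ℕ) → maxL zs ≡ 0 ⊎ maxL zs ∈ zs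
maxL-attained [] = inj₁ refl
maxL-attained (z ∷ zs) with ℕ.⊔-sel z (maxL zs)
... | inj₁ max≡z = inj₂ (here max≡z)
... | inj₂ max≡rest with maxL-attained zs
...   | inj₁ rest≡0 = inj₁ (≡.trans max≡rest rest≡0)
...   | inj₂ rest∈zs = inj₂ (there (subst (_∈ zs) (≡.sym max≡rest) rest∈zs))

maxL-bound : ∀ (zs : List ℕ) {B : ℚ} → 0ℚ ≤ B → (∀ {z} → z ∈ zs → ι z ≤ B) → ι (maxL zs) ≤ B
maxL-bound zs 0≤B bound with maxL-attained zs
... | inj₁ max≡0 = subst (λ z → ι z ≤ _) (≡.sym max≡0) 0≤B
... | inj₂ max∈zs = bound max∈zs

module Game {n k : ℕ} (part : Fin n → Fin k) where
  open Classes part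

  G : Graph n
  G = completeMultipartite part

  moveValue : ℕ → VSet n → VSet n → ℕ
  moveValue f U M = size M ℕ.+ minL (List.map (λ X → gameValue G f (minus U X)) (painterMoves G M))

  -- Against any legal move, Painter answers as in painter-round; the round
  -- score plus the remaining game is bounded by the current potential.
  move-bound : ∀ f U M {s p} → Certificate (count U) s p → nonempty M ≡ true → isSub M U ≡ true →
               (∀ U′ {s′ p′} → Certificate (count U′) s′ p′ → ι (gameValue G f U′) ≤ Φ s′ p′) →
               ι (moveValue f U M) ≤ Φ s p
  move-bound f U M {s} {p} C M≠∅ M⊆U rest-bound = begin
      ι (moveValue f U M)
    ≡⟨ ι-+ (size M) (minL answers) ⟩
      ι (size M) + ι (minL answers)
    ≤⟨ +-mono-≤ (≤-reflexive (cong ι (size-by-classes M))) (≤-trans (ι-mono answer≤) (rest-bound U′ C′)) ⟩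
      ι (∑ℕ (count M)) + Φ budget weight
    ≤⟨ drop ⟩
      Φ s p
    ∎
    where
    open ≤-Reasoning
    open Answer (Round.painter-round C (count M) (λ i → count-mono U M i M⊆U)
                               (subst (0 ℕ.<_) (size-by-classes M) (nonempty⇒size-pos M M≠∅)))
    answers : List ℕ
    answers = List.map (λ X → gameValue G f (minus U X)) (painterMoves G M)
    X U′ : VSet n
    X = restrict M class
    U′ = minus U X
    C′ : Certificate (count U′) budget weight
    C′ = next {count U′} (count-colored U M class M⊆U) (λ j i≢j → count-untouched U M i≢j)
    X-legal : X ∈ painterMoves G M
    X-legal = ∈-filterᵇ⁺ (λ X → nonempty X ∧ isSub X M ∧ independent G X) (∈-allSubsets X)
                (cong₂ _∧_ (restrict-nonempty M class nonzero) (cong₂ _∧_ (restrict-⊆ M class) (restrict-independent M class)))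
    answer≤ : minL answers ℕ.≤ gameValue G f U′
    answer≤ = minL≤ answers (∈-map⁺ (λ X → gameValue G f (minus U X)) X-legal)

  game-bound : ∀ f U {s p} → Certificate (count U) s p → ι (gameValue G f U) ≤ Φ s p
  game-bound zero U C = Φ-nonNeg C
  game-bound (suc f) U {s} {p} C = maxL-bound (List.map (moveValue f U) (listerMoves U)) (Φ-nonNeg C) every-move
    where
    every-move : ∀ {z} → z ∈ List.map (moveValue f U) (listerMoves U) → ι z ≤ Φ s p
    every-move z∈ with ∈-map⁻ (moveValue f U) z∈
    ... | M , M-legal , refl = move-bound f U M C (∧-conicalˡ (nonempty M) (isSub M U) M-ok) (∧-conicalʳ (nonempty M) (isSub M U) M-ok)
                                 (λ U′ → game-bound f U′)
      where
      M-ok : nonempty M ∧ isSub M U ≡ true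
      M-ok = ∈-filterᵇ⁻ (λ M → nonempty M ∧ isSub M U) {xs = allSubsets n} M-legal

listSum : ∀ {A : Set} → (A → ℚ) → List A → ℚ
listSum h = List.foldr (λ a acc → h a + acc) 0ℚ

listSum-++ : ∀ {A : Set} (h : A → ℚ) xs ys → listSum h (xs List.++ ys) ≡ listSum h xs + listSum h ys
listSum-++ h [] ys = ≡.sym (+-identityˡ (listSum h ys))
listSum-++ h (x ∷ xs) ys = ≡.trans (cong (h x +_) (listSum-++ h xs ys)) (≡.sym (+-assoc (h x) _ _))

listSum-concatMap : ∀ {A B : Set} (h : B → ℚ) (f : A → List B) xs →
                    listSum h (List.concatMap f xs) ≡ listSum (listSum h ∘ f) xs
listSum-concatMap h f [] = refl
listSum-concatMap h f (x ∷ xs) = ≡.trans (listSum-++ h (f x) (List.concatMap f xs)) (cong (listSum h (f x) +_) (listSum-concatMap h f xs))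

listSum-map-filter : ∀ {A B : Set} (h : B → ℚ) (g : A → B) (P : A → Bool) xs →
                     listSum h (List.map g (filterᵇ P xs)) ≡ listSum (λ x → if P x then h (g x) else 0ℚ) xs
listSum-map-filter h g P [] = refl
listSum-map-filter h g P (x ∷ xs) with P x
... | true  = cong (h (g x) +_) (listSum-map-filter h g P xs)
... | false = ≡.trans (listSum-map-filter h g P xs) (≡.sym (+-identityˡ _))

listSum-tabulate : ∀ {A : Set} {k} (h : A → ℚ) (g : Fin k → A) → listSum h (List.tabulate g) ≡ ∑ (h ∘ g)
listSum-tabulate {k = zero} h g = refl
listSum-tabulate {k = suc k} h g = cong (h (g zero) +_) (listSum-tabulate h (g ∘ suc))

module Initial (n k : ℕ) (r : Fin k → ℕ) (part : Fin n → Fin k) (part-sizes : ∀ i → partSize part i ≡ r i)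
               (q : Fin k → Fin k → ℚ)
               (q-bound : ∀ i j → toℕ i ℕ.< toℕ j → (0ℚ ≤ q i j) × (ℕtoℚ (r i ℕ.* r j) ≤ q i j · q i j)) where
  open Classes part

  above : Fin k → Fin k → ℚ
  above i j = if toℕ i <ᵇ toℕ j then q i j else 0ℚ

  above-< : ∀ {i j} → toℕ i ℕ.< toℕ j → above i j ≡ q i j
  above-< i<j rewrite Equivalence.to T-≡ (ℕ.<⇒<ᵇ i<j) = refl

  above-≮ : ∀ {i j} → ¬ toℕ i ℕ.< toℕ j → above i j ≡ 0ℚ
  above-≮ {i} {j} i≮j with toℕ i <ᵇ toℕ j in eq
  ... | true  = contradiction (ℕ.<ᵇ⇒< (toℕ i) (toℕ j) (Equivalence.from T-≡ eq)) i≮j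
  ... | false = refl

  s : Fin k → ℚ
  s i = ι (r i)

  p : Fin k → Fin k → ℚ
  p i j = above i j + above j i

  full : VSet n
  full = replicate n true

  certificate : Certificate (count full) s p
  certificate = record
    { covers        = λ i → ≤-reflexive (cong ι (≡.trans (count-full i) (part-sizes i)))
    ; weight-nonNeg = λ i j → nonNeg-+ (above-nonNeg i j) (above-nonNeg j i)
    ; symmetric     = λ i j → +-comm (above i j) (above j i)
    ; diagonal      = λ i → ≡.trans (cong₂ _+_ (above-≮ {i} {i} (ℕ.<-irrefl refl)) (above-≮ {i} {i} (ℕ.<-irrefl refl))) (+-identityˡ 0ℚ)
    ; geometric     = geometric
    }
    where
    above-nonNeg : ∀ i j → 0ℚ ≤ above i j
    above-nonNeg i j with toℕ i ℕ.<? toℕ j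
    ... | yes i<j = subst (0ℚ ≤_) (≡.sym (above-< i<j)) (proj₁ (q-bound i j i<j))
    ... | no i≮j = ≤-reflexive (≡.sym (above-≮ i≮j))
    bound-< : ∀ i j → toℕ i ℕ.< toℕ j → s i · s j ≤ q i j · q i j
    bound-< i j i<j = subst (_≤ q i j · q i j) (≡.trans (ℕtoℚ≡ι (r i ℕ.* r j)) (ι-* (r i) (r j))) (proj₂ (q-bound i j i<j))
    geometric : ∀ i j → i ≢ j → s i · s j ≤ p i j · p i j
    geometric i j i≢j with ℕ.<-cmp (toℕ i) (toℕ j)
    ... | tri< i<j _ j≮i rewrite above-< i<j | above-≮ j≮i | +-identityʳ (q i j) = bound-< i j i<j
    ... | tri≈ _ i≡j _ = contradiction (toℕ-injective i≡j) i≢j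
    ... | tri> i≮j _ j<i rewrite above-≮ i≮j | above-< j<i | +-identityˡ (q j i) | *-comm (s i) (s j) = bound-< j i j<i

  pairSum≡ : pairSumℚ k q ≡ ∑ (λ i → ∑ (above i))
  pairSum≡ = begin
      pairSumℚ k q
    ≡⟨ listSum-concatMap (λ ij → q (proj₁ ij) (proj₂ ij)) pairs-from (allFin k) ⟩
      listSum (λ i → listSum (λ ij → q (proj₁ ij) (proj₂ ij)) (pairs-from i)) (allFin k)
    ≡⟨ listSum-tabulate (λ i → listSum (λ ij → q (proj₁ ij) (proj₂ ij)) (pairs-from i)) id ⟩
      ∑ (λ i → listSum (λ ij → q (proj₁ ij) (proj₂ ij)) (pairs-from i))
    ≡⟨ ∑-cong (λ i → ≡.trans (listSum-map-filter (λ ij → q (proj₁ ij) (proj₂ ij)) (i ,_) (λ j → toℕ i <ᵇ toℕ j) (allFin k))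
                              (listSum-tabulate (above i) id)) ⟩
      ∑ (λ i → ∑ (above i))
    ∎
    where
    open ≡-Reasoning
    pairs-from : Fin k → List (Fin k × Fin k)
    pairs-from i = List.map (i ,_) (filterᵇ (λ j → toℕ i <ᵇ toℕ j) (allFin k))

  classes-cover : ∑ℕ r ≡ n
  classes-cover = ≡.trans (∑ℕ-cong {x = r} {y = count full} (λ i → ≡.sym (≡.trans (count-full i) (part-sizes i))))
                  (≡.trans (≡.sym (size-by-classes full)) (size-full n))

  potential : Φ s p ≡ ℕtoℚ n + ℕtoℚ 2 · pairSumℚ k q
  potential = begin
      ∑ s + ∑ (λ i → ∑ (λ j → above i j + above j i))
    ≡⟨ cong₂ _+_ budgets (∑-cong (λ i → ∑-distrib-+ (above i) (λ j → above j i))) ⟩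
      ι n + ∑ (λ i → ∑ (above i) + ∑ (λ j → above j i))
    ≡⟨ cong (ι n +_) (∑-distrib-+ (λ i → ∑ (above i)) (λ i → ∑ (λ j → above j i))) ⟩
      ι n + (W + ∑ (λ i → ∑ (λ j → above j i)))
    ≡⟨ cong (λ z → ι n + (W + z)) (∑-comm (λ i j → above j i)) ⟩
      ι n + (W + W)
    ≡⟨ cong₂ _+_ (≡.sym (ℕtoℚ≡ι n)) (≡.trans (solve 1 (λ W → W :+ W := con two :* W) refl W) (cong (_· W) (≡.sym (ℕtoℚ≡ι 2)))) ⟩
      ℕtoℚ n + ℕtoℚ 2 · W
    ≡⟨ cong (λ z → ℕtoℚ n + ℕtoℚ 2 · z) (≡.sym pairSum≡) ⟩
      ℕtoℚ n + ℕtoℚ 2 · pairSumℚ k q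
    ∎
    where
    open ≡-Reasoning
    W : ℚ
    W = ∑ (λ i → ∑ (above i))
    budgets : ∑ s ≡ ι n
    budgets = ≡.trans (≡.sym (ι-∑ r)) (cong ι classes-cover)

open import Data.Nat using (ℕ; _*_; _<_)
open import Data.Nat as N using ()
open import Data.Fin using (Fin; toℕ)
open import Data.Product using (_×_)
open import Data.Rational as Q using (ℚ; 0ℚ)
open import Relation.Binary.PropositionalEquality using (_≡_)

-- The initial certificate bounds the game from its start.
corollary2 : (n k : ℕ) (r : Fin k → ℕ) (part : Fin n → Fin k) →
    (∀ i → partSize part i ≡ r i) →
    (∀ i → 1 N.≤ r i) →
    (q : Fin k → Fin k → ℚ) →
    (∀ i j → toℕ i < toℕ j → (0ℚ Q.≤ q i j) × (ℕtoℚ (r i * r j) Q.≤ q i j Q.* q i j)) →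
    ℕtoℚ (sumColorCost (completeMultipartite part)) Q.≤ ℕtoℚ n Q.+ ℕtoℚ 2 Q.* pairSumℚ k q
corollary2 n k r part part-sizes _ q q-bound =
  subst₂ Q._≤_ (≡.sym (ℕtoℚ≡ι _)) potential (Game.game-bound part n full certificate)
  where open Initial n k r part part-sizes q q-bound
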